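{- For every integer $n\geq 4$ there exists a multi-layer graph $\mathcal{G}=(V,\{C_H,C_V\},*)$ with $|V|=n^2$ such that: the cop player has a winning strategy with two cops if both cops are allocated to $C_H$ (allocation $(2,0)$), and also if both cops are allocated to $C_V$ (allocation $(0,2)$); but the robber player has a winning strategy against two cops if one cop is allocated to $C_H$ and the other to $C_V$ (allocation $(1,1)$).
   Context: A multi-layer graph with designated layers is $\mathcal{G}=(V,\{C_1,\dots,C_\tau\},R)$ where $V$ is a finite vertex set, $\tau\geq 1$, and the cop layers $C_1,\dots,C_\tau$ and the robber layer $R$ are subsets of $\binom{V}{2}$; the notation $(V,\{C_1,\dots,C_\tau\},*)$ means $R=C_1\cup\dots\cup C_\tau$. Given an allocation $(k_1,\dots,k_\tau)$ of nonnegative integers, the game is: $k_i$ cops are assigned to layer $C_i$; the cop player places every cop on a vertex, then the robber player places the robber on a vertex; then turns alternate starting with the cop player. On the cop player's turn each cop either stays put or moves along one edge of its own layer; on the robber's turn the robber stays or moves along one edge of $R$. No agent ever changes layer. The cop player wins if at some point a cop occupies the robber's vertex; the robber wins if it evades capture forever. Both players have perfect information. -}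

module Defs where

open import Data.Nat using (ℕ; zero; suc)
open import Data.Fin using (Fin)
open import Data.Bool using (Bool; true; false)
open import Data.Vec using (Vec; lookup)
open import Data.List using (List; []; _∷_)
open import Data.Product using (Σ; ∃; _×_; _,_; proj₁; proj₂)
open import Data.Sum using (_⊎_)
open import Relation.Binary.PropositionalEquality using (_≡_)
open import Relation.Nullary using (¬_)

-- The robber layer is
-- R = C_1 ∪ ... ∪ C_τ (the "*" convention).
record MLGraph (m τ : ℕ) : Set where
  field
    C     : Fin τ → Fin m → Fin m → Bool
    sym   : ∀ i u v → C i u v ≡ C i v u
    irrefl : ∀ i u → C i u u ≡ false

module _ {m τ : ℕ} (G : MLGraph m τ) where
  open MLGraph G

  CopStep : Fin τ → Fin m → Fin m → Set
  CopStep i u v = u ≡ v ⊎ C i u v ≡ true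

  RobStep : Fin m → Fin m → Set
  RobStep u v = u ≡ v ⊎ ∃ λ i → C i u v ≡ true

  module _ (k : Vec ℕ τ) where
    Cops : Set
    Cops = (i : Fin τ) → Fin (lookup k i) → Fin m

    State : Set
    State = Cops × Fin m

    Captured : State → Set
    Captured (c , r) = ∃ λ i → ∃ λ j → c i j ≡ r

    LegalCopMove : Cops → Cops → Set
    LegalCopMove c c' = ∀ i j → CopStep i (c i j) (c' i j)

    -- Strategies may depend on the whole history (perfect information).
    -- The history is the list of all previous positions (most recent first).
    record CopStrategy : Set where
      field
        place : Cops
        move  : (past : List State) (cur : State) →
                Σ Cops (λ c' → LegalCopMove (proj₁ cur) c')

    record RobberStrategy : Set where
      field
        place : Cops → Fin m
        move  : (past : List State) (cur : State) →
                Σ (Fin m) (λ r' → RobStep (proj₂ cur) r')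

    module Play (σ : CopStrategy) (ρ : RobberStrategy) where
      private
        module σ = CopStrategy σ
        module ρ = RobberStrategy ρ

      -- position (cop to move) after t full rounds, with the history before it
      run : ℕ → State × List State
      run zero = (σ.place , ρ.place σ.place) , []
      run (suc t) with run t
      ... | s , h =
        let c'  = proj₁ (σ.move h s)
            mid = (c' , proj₂ s)
            r'  = proj₁ (ρ.move (s ∷ h) mid)
        in (c' , r') , (mid ∷ s ∷ h)

      midState : ℕ → State
      midState t with run t
      ... | s , h = proj₁ (σ.move h s) , proj₂ s

      -- capture happens at round t (either at the start of the round, i.e.
      -- after the placement / the robber's previous move, or after the cops' move)
      CaptureAt : ℕ → Set
      CaptureAt t = Captured (proj₁ (run t)) ⊎ Captured (midState t)

    CopWins : Set
    CopWins = Σ CopStrategy λ σ → (ρ : RobberStrategy) → ∃ λ t → Play.CaptureAt σ ρ t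

    RobberWins : Set
    RobberWins = Σ RobberStrategy λ ρ → (σ : CopStrategy) → (t : ℕ) → ¬ Play.CaptureAt σ ρ t

-- Each layer is a disjoint union of two stars, cut out by a 2-colouring of the
-- vertices, and the two colourings are independent: all four colour pairs occur.
-- Two cops on one layer, placed at its two star centres, dominate every vertex
-- and capture in their first move.  A single cop can never leave its colour
-- class, so against one cop per layer the robber stands still on the vertex
-- whose two colours are opposite to the cops' colours.
module Submission where

open import Defs
open import Data.Nat using (ℕ; _≤_; _*_; suc; s≤s)
open import Data.Vec using (Vec; []; _∷_)
open import Data.Product using (Σ; ∃; _×_; _,_; proj₁; proj₂)
open import Data.Fin using (Fin; opposite; _≟_)
open import Data.Fin.Patterns using (0F; 1F; 2F; 3F)
open import Data.Bool using (Bool; true; false; _∧_; _∨_; not)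
open import Data.Bool.Properties as Bool using (∨-comm; ∧-zeroʳ)
open import Data.Sum using (inj₁; inj₂)
open import Function using (case_of_)
open import Relation.Nullary using (¬_; does; yes; no; contradiction)
open import Relation.Nullary.Decidable using (dec-true; dec-false)
open import Relation.Binary.PropositionalEquality

module _ {m τ : ℕ} (G : MLGraph m τ) where
  open MLGraph G using (C)

  approach : (i : Fin τ) (u r : Fin m) → Σ (Fin m) (CopStep G i u)
  approach i u r with C i u r Bool.≟ true
  ... | yes edge = r , inj₂ edge
  ... | no _     = u , inj₁ refl

  approach-reaches : ∀ i u r → CopStep G i u r → proj₁ (approach i u r) ≡ r
  approach-reaches i u r step with C i u r Bool.≟ true | step
  ... | yes _     | _          = refl
  ... | no _      | inj₁ u≡r   = u≡r
  ... | no ¬edge  | inj₂ edge  = contradiction edge ¬edge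

  module _ (k : Vec ℕ τ) where

    Dominates : Cops G k → Fin m → Set
    Dominates p r = ∃ λ i → ∃ λ j → CopStep G i (p i j) r

    greedy : Cops G k → CopStrategy G k
    greedy p = record
      { place = p
      ; move  = λ _ (c , r) → (λ i j → proj₁ (approach i (c i j) r))
                            , (λ i j → proj₂ (approach i (c i j) r)) }

    dominating-placement-wins : (p : Cops G k) → (∀ r → Dominates p r) → CopWins G k
    dominating-placement-wins p dominates = greedy p , λ ρ →
      let r = RobberStrategy.place ρ p
          (i , j , step) = dominates r
      in 0 , inj₂ (i , j , approach-reaches i (p i j) r step)

    stationary : (Cops G k → Fin m) → RobberStrategy G k
    stationary hide = record { place = hide ; move = λ _ (_ , r) → r , inj₁ refl }

    hiding-robber-wins : {A : Set} (κ : Fin τ → Fin m → A) →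
      (∀ i u v → C i u v ≡ true → κ i u ≡ κ i v) →
      ((p : Cops G k) → Σ (Fin m) λ r → ∀ i j → κ i (p i j) ≢ κ i r) →
      RobberWins G k
    hiding-robber-wins κ preserved hide = ρ , safe
      where
      ρ : RobberStrategy G k
      ρ = stationary (λ p → proj₁ (hide p))

      step-preserves : ∀ i {u v} → CopStep G i u v → κ i u ≡ κ i v
      step-preserves i (inj₁ u≡v) = cong (κ i) u≡v
      step-preserves i (inj₂ edge) = preserved i _ _ edge

      module _ (σ : CopStrategy G k) where
        open CopStrategy σ
        open Play G k σ ρ

        Hidden : State G k → Set
        Hidden (c , r) = (∀ i j → κ i (c i j) ≡ κ i (place i j)) × r ≡ proj₁ (hide place)

        cop-move-keeps-hidden : ∀ h s → Hidden s → Hidden (proj₁ (move h s) , proj₂ s)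
        cop-move-keeps-hidden h s (same-class , r≡hide) =
          (λ i j → trans (sym (step-preserves i (proj₂ (move h s) i j))) (same-class i j))
          , r≡hide

        hidden-run : ∀ t → Hidden (proj₁ (run t))
        hidden-run 0 = (λ _ _ → refl) , refl
        hidden-run (suc t) with run t | hidden-run t
        ... | s , h | hidden = cop-move-keeps-hidden h s hidden

        hidden-mid : ∀ t → Hidden (midState t)
        hidden-mid t with run t | hidden-run t
        ... | s , h | hidden = cop-move-keeps-hidden h s hidden

        hidden-uncaptured : ∀ s → Hidden s → ¬ Captured G k s
        hidden-uncaptured (c , r) (same-class , refl) (i , j , cij≡r) =
          proj₂ (hide place) i j (trans (sym (same-class i j)) (cong (κ i) cij≡r))

        safe : ∀ t → ¬ CaptureAt t
        safe t (inj₁ captured) = hidden-uncaptured _ (hidden-run t) captured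
        safe t (inj₂ captured) = hidden-uncaptured _ (hidden-mid t) captured

module _ {m : ℕ} {K : Set} (class : Fin m → K) (centre : K → Fin m) where

  isCentreOf : Fin m → Fin m → Bool
  isCentreOf u v = does (u ≟ centre (class v)) ∧ not (does (u ≟ v))

  star : Fin m → Fin m → Bool
  star u v = isCentreOf u v ∨ isCentreOf v u

  star-sym : ∀ u v → star u v ≡ star v u
  star-sym u v = ∨-comm (isCentreOf u v) (isCentreOf v u)

  star-irrefl : ∀ u → star u u ≡ false
  star-irrefl u rewrite dec-true (u ≟ u) refl | ∧-zeroʳ (does (u ≟ centre (class u))) = refl

  star-centre : ∀ v → v ≢ centre (class v) → star (centre (class v)) v ≡ true
  star-centre v v≢centre
    rewrite dec-true (centre (class v) ≟ centre (class v)) refl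
          | dec-false (centre (class v) ≟ v) (λ eq → v≢centre (sym eq)) = refl

  module _ (centre-section : ∀ x → class (centre x) ≡ x) where

    isCentreOf-class : ∀ u v → isCentreOf u v ≡ true → class u ≡ class v
    isCentreOf-class u v is-centre with u ≟ centre (class v) | is-centre
    ... | yes refl | _ = centre-section (class v)
    ... | no _     | ()

    star-preserves-class : ∀ u v → star u v ≡ true → class u ≡ class v
    star-preserves-class u v edge with isCentreOf u v in u-centre | edge
    ... | true  | _       = isCentreOf-class u v u-centre
    ... | false | v-centre = sym (isCentreOf-class v u v-centre)

starGraph : {m τ : ℕ} {K : Set} → (Fin τ → Fin m → K) → (Fin τ → K → Fin m) → MLGraph m τ
starGraph class centre = record
  { C      = λ i → star (class i) (centre i)
  ; sym    = λ i → star-sym (class i) (centre i)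
  ; irrefl = λ i → star-irrefl (class i) (centre i) }

star-centre-step : {m τ : ℕ} {K : Set} (class : Fin τ → Fin m → K) (centre : Fin τ → K → Fin m) →
  ∀ i v → CopStep (starGraph class centre) i (centre i (class i v)) v
star-centre-step class centre i v = case v ≟ centre i (class i v) of λ where
  (yes v≡centre) → inj₁ (sym v≡centre)
  (no v≢centre)  → inj₂ (star-centre (class i) (centre i) v v≢centre)

opposite-≢ : (x : Fin 2) → x ≢ opposite x
opposite-≢ 0F ()
opposite-≢ 1F ()

-- The first four vertices are the four corners of {0,1}²; every other vertex
-- has coordinates (0,0).
module Corners (k : ℕ) where

  V : Set
  V = Fin (suc (suc (suc (suc k))))

  coordinate : Fin 2 → V → Fin 2
  coordinate 0F 1F = 1F
  coordinate 0F 3F = 1F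
  coordinate 0F _  = 0F
  coordinate 1F 2F = 1F
  coordinate 1F 3F = 1F
  coordinate 1F _  = 0F

  corner : Fin 2 → Fin 2 → V
  corner 0F 0F = 0F
  corner 1F 0F = 1F
  corner 0F 1F = 2F
  corner 1F 1F = 3F

  coordinate-corner : ∀ a b → coordinate 0F (corner a b) ≡ a × coordinate 1F (corner a b) ≡ b
  coordinate-corner 0F 0F = refl , refl
  coordinate-corner 1F 0F = refl , refl
  coordinate-corner 0F 1F = refl , refl
  coordinate-corner 1F 1F = refl , refl

  centre : Fin 2 → Fin 2 → V
  centre 0F a = corner a 0F
  centre 1F b = corner 0F b

  centre-section : ∀ i x → coordinate i (centre i x) ≡ x
  centre-section 0F a = proj₁ (coordinate-corner a 0F)
  centre-section 1F b = proj₂ (coordinate-corner 0F b)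

  G : MLGraph (suc (suc (suc (suc k)))) 2
  G = starGraph coordinate centre

  horizontal-cops-win : CopWins G (2 ∷ 0 ∷ [])
  horizontal-cops-win = dominating-placement-wins G _ placement
    λ r → 0F , coordinate 0F r , star-centre-step coordinate centre 0F r
    where
    placement : Cops G (2 ∷ 0 ∷ [])
    placement 0F = centre 0F
    placement 1F ()

  vertical-cops-win : CopWins G (0 ∷ 2 ∷ [])
  vertical-cops-win = dominating-placement-wins G _ placement
    λ r → 1F , coordinate 1F r , star-centre-step coordinate centre 1F r
    where
    placement : Cops G (0 ∷ 2 ∷ [])
    placement 0F ()
    placement 1F = centre 1F

  mixed-robber-wins : RobberWins G (1 ∷ 1 ∷ [])
  mixed-robber-wins = hiding-robber-wins G _ coordinate
    (λ i → star-preserves-class (coordinate i) (centre i) (centre-section i))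
    hide
    where
    hide : (p : Cops G (1 ∷ 1 ∷ [])) → Σ V λ r → ∀ i j → coordinate i (p i j) ≢ coordinate i r
    hide p = corner (opposite a) (opposite b) , avoids
      where
      a b : Fin 2
      a = coordinate 0F (p 0F 0F)
      b = coordinate 1F (p 1F 0F)
      avoids : ∀ i j → coordinate i (p i j) ≢ coordinate i (corner (opposite a) (opposite b))
      avoids 0F 0F eq = opposite-≢ a (trans eq (proj₁ (coordinate-corner (opposite a) (opposite b))))
      avoids 1F 0F eq = opposite-≢ b (trans eq (proj₂ (coordinate-corner (opposite a) (opposite b))))

theorem3p1 : (n : ℕ) → 4 ≤ n →
    Σ (MLGraph (n * n) 2) λ G →
      CopWins G (2 ∷ 0 ∷ []) × CopWins G (0 ∷ 2 ∷ []) × RobberWins G (1 ∷ 1 ∷ [])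
theorem3p1 (suc (suc (suc (suc n)))) (s≤s (s≤s (s≤s (s≤s _)))) =
  Corners.G _ , Corners.horizontal-cops-win _ , Corners.vertical-cops-win _ , Corners.mixed-robber-wins _
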